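{- Let $T$ be a complete binary tree and let $X$ be a subtree of $T$ (a node of $T$ together with all its descendants), with node set $V_X$ and set of internal (non-leaf) nodes $I(V_X)$. For any subset $S\subseteq I(V_X)$, $|\partial S\cap V_X|\ge |S\cap V_X|$. In particular, if $S$ is nonempty, then $|\partial S\cap V_X|\ge |S\cap V_X|+1$.
   Context: $\partial S$ denotes the node boundary of $S$ in $T$: the set of nodes of $T$ not in $S$ that are adjacent in $T$ to at least one node of $S$. -}

module Defs where

open import Data.Bool using (Bool; true; false; _∧_; _∨_; not)
open import Data.List using (List; []; _∷_; _++_; [_]; length; concatMap; filterᵇ)
open import Data.Bool.ListAction using (any)
open import Data.Nat using (ℕ; zero; suc; _≤ᵇ_; _<ᵇ_)

-- The complete (perfect) binary tree T_d of depth d.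
-- A node is encoded by the path from the root, most recent step FIRST:
-- the root is [], and the two children of u are false ∷ u and true ∷ u.
Node : Set
Node = List Bool

children : Node → List Node
children u = (false ∷ u) ∷ (true ∷ u) ∷ []

level : ℕ → List Node
level zero = [ [] ]
level (suc k) = concatMap children (level k)

nodes : ℕ → List Node
nodes zero = level zero
nodes (suc d) = nodes d ++ level (suc d)

inT : ℕ → Node → Bool
inT d u = length u ≤ᵇ d

internal : ℕ → Node → Bool
internal d u = length u <ᵇ d

-- tree neighbours (parent and children) of a node, in the infinite tree;
-- adjacency in T_d = both endpoints in T_d and one is a neighbour of the other
neighbours : Node → List Node
neighbours [] = children []
neighbours (b ∷ u) = u ∷ children (b ∷ u)

Subset : Set
Subset = Node → Bool

_∩_ : Subset → Subset → Subset
(A ∩ B) u = A u ∧ B u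

-- cardinality of (the part inside T_d of) a subset
card : ℕ → Subset → ℕ
card d A = length (filterᵇ A (nodes d))

∂ : ℕ → Subset → Subset
∂ d S u = inT d u ∧ (not (S u) ∧ any (λ w → inT d w ∧ S w) (neighbours u))

eqNode : Node → Node → Bool
eqNode [] [] = true
eqNode [] (_ ∷ _) = false
eqNode (_ ∷ _) [] = false
eqNode (true ∷ u) (true ∷ v) = eqNode u v
eqNode (false ∷ u) (false ∷ v) = eqNode u v
eqNode (true ∷ u) (false ∷ v) = false
eqNode (false ∷ u) (true ∷ v) = false

isDesc : Node → Node → Bool
isDesc r [] = eqNode [] r
isDesc r (b ∷ u) = eqNode (b ∷ u) r ∨ isDesc r u

VX : ℕ → Node → Subset
VX d r u = inT d u ∧ isDesc r u

-- Let B be the set of nodes outside S whose parent lies in S.  Every node of S is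
-- internal, so it has two children, each lying either in B or in S; the children in S
-- are exactly the nodes of S whose parent is in S.  Hence |B| = 2|S| − |S ∖ tops| =
-- |S| + |tops|, where the tops of S are its nodes whose parent is not in S, and a
-- nonempty S has a top.  Finally B ⊆ ∂S ∩ V_X, since V_X is closed under children.
module Submission where

open import Defs
open import Data.Bool using (true; false; _∧_; not; if_then_else_; T)
open import Data.Bool.Properties using (∨-zeroʳ)
open import Data.List using (List; []; _∷_; _++_; length; concatMap; filterᵇ)
open import Data.Nat using (ℕ; zero; suc; _≥_; _≤_; _<_; _+_; z≤n; s≤s)
open import Data.Nat.Properties
open import Algebra.Properties.CommutativeSemigroup +-commutativeSemigroup using (interchange)
open import Data.Empty using (⊥-elim)
open import Data.Product using (_×_; ∃; _,_; proj₁; proj₂)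
open import Function using (_∘_)
open import Data.Sum using (_⊎_; inj₁; inj₂)
open import Data.Unit using (tt)
open import Relation.Binary.PropositionalEquality

_⊆_ : Subset → Subset → Set
A ⊆ B = ∀ u → A u ≡ true → B u ≡ true

internal⇒< : ∀ d u → internal d u ≡ true → length u < d
internal⇒< d u int = <ᵇ⇒< (length u) d (subst T (sym int) tt)

χ : Subset → Node → ℕ
χ A u = if A u then 1 else 0

∑ : (Node → ℕ) → List Node → ℕ
∑ f [] = 0
∑ f (u ∷ us) = f u + ∑ f us

∑-++ : ∀ f us vs → ∑ f (us ++ vs) ≡ ∑ f us + ∑ f vs
∑-++ f [] vs = refl
∑-++ f (u ∷ us) vs = trans (cong (f u +_) (∑-++ f us vs)) (sym (+-assoc (f u) _ _))

∑-+ : ∀ f g us → ∑ (λ u → f u + g u) us ≡ ∑ f us + ∑ g us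
∑-+ f g [] = refl
∑-+ f g (u ∷ us) = trans (cong (f u + g u +_) (∑-+ f g us)) (interchange (f u) (g u) _ _)

∑-mono : ∀ {f g} → (∀ u → f u ≤ g u) → ∀ us → ∑ f us ≤ ∑ g us
∑-mono f≤g [] = z≤n
∑-mono f≤g (u ∷ us) = +-mono-≤ (f≤g u) (∑-mono f≤g us)

∑-cong : ∀ {f g} → (∀ u → f u ≡ g u) → ∀ us → ∑ f us ≡ ∑ g us
∑-cong f≡g [] = refl
∑-cong f≡g (u ∷ us) = cong₂ _+_ (f≡g u) (∑-cong f≡g us)

∑-concatMap-children : ∀ f us →
  ∑ f (concatMap children us) ≡ ∑ (λ u → f (false ∷ u) + f (true ∷ u)) us
∑-concatMap-children f [] = refl
∑-concatMap-children f (u ∷ us) = begin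
  ∑ f (children u ++ concatMap children us)          ≡⟨ ∑-++ f (children u) (concatMap children us) ⟩
  f (false ∷ u) + (f (true ∷ u) + 0) + ∑ f (concatMap children us)
    ≡⟨ cong₂ _+_ (cong (f (false ∷ u) +_) (+-identityʳ _)) (∑-concatMap-children f us) ⟩
  f (false ∷ u) + f (true ∷ u) + ∑ (λ v → f (false ∷ v) + f (true ∷ v)) us ∎
  where open ≡-Reasoning

length-filterᵇ : ∀ A us → length (filterᵇ A us) ≡ ∑ (χ A) us
length-filterᵇ A [] = refl
length-filterᵇ A (u ∷ us) with A u
... | true = cong suc (length-filterᵇ A us)
... | false = length-filterᵇ A us

∑-level-≡0 : ∀ f k → (∀ u → length u ≡ k → f u ≡ 0) → ∑ f (level k) ≡ 0
∑-level-≡0 f zero f≡0 = cong (_+ 0) (f≡0 [] refl)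
∑-level-≡0 f (suc k) f≡0 =
  trans (∑-concatMap-children f (level k))
    (∑-level-≡0 (λ u → f (false ∷ u) + f (true ∷ u)) k
      (λ u ∣u∣≡k → cong₂ _+_ (f≡0 (false ∷ u) (cong suc ∣u∣≡k)) (f≡0 (true ∷ u) (cong suc ∣u∣≡k))))

≤∑-level : ∀ f u → f u ≤ ∑ f (level (length u))
≤∑-level f [] = m≤m+n (f []) 0
≤∑-level f (b ∷ u) =
  subst (f (b ∷ u) ≤_) (sym (∑-concatMap-children f (level (length u))))
    (≤-trans (≤-sibling-sum b) (≤∑-level (λ v → f (false ∷ v) + f (true ∷ v)) u))
  where
  ≤-sibling-sum : ∀ b → f (b ∷ u) ≤ f (false ∷ u) + f (true ∷ u)
  ≤-sibling-sum false = m≤m+n _ _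
  ≤-sibling-sum true = m≤n+m _ _

∑-level≤∑-nodes : ∀ f {k} d → k ≤ d → ∑ f (level k) ≤ ∑ f (nodes d)
∑-level≤∑-nodes f zero z≤n = ≤-refl
∑-level≤∑-nodes f {k} (suc d) k≤1+d =
  subst (∑ f (level k) ≤_) (sym (∑-++ f (nodes d) (level (suc d))))
    (≤-level-or-earlier (m≤n⇒m<n∨m≡n k≤1+d))
  where
  ≤-level-or-earlier : k < suc d ⊎ k ≡ suc d → ∑ f (level k) ≤ ∑ f (nodes d) + ∑ f (level (suc d))
  ≤-level-or-earlier (inj₁ (s≤s k≤d)) = ≤-trans (∑-level≤∑-nodes f d k≤d) (m≤m+n _ _)
  ≤-level-or-earlier (inj₂ refl) = m≤n+m _ _

∑-nodes-suc : ∀ f d → f [] ≡ 0 →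
  ∑ f (nodes (suc d)) ≡ ∑ (λ u → f (false ∷ u) + f (true ∷ u)) (nodes d)
∑-nodes-suc f zero f[]≡0 = begin
  f [] + ∑ f (level 1)                    ≡⟨ cong (_+ ∑ f (level 1)) f[]≡0 ⟩
  ∑ f (level 1)                           ≡⟨ ∑-concatMap-children f (level 0) ⟩
  ∑ (λ u → f (false ∷ u) + f (true ∷ u)) (level 0) ∎
  where open ≡-Reasoning
∑-nodes-suc f (suc d) f[]≡0 = begin
  ∑ f (nodes (suc d) ++ level (suc (suc d)))          ≡⟨ ∑-++ f (nodes (suc d)) _ ⟩
  ∑ f (nodes (suc d)) + ∑ f (level (suc (suc d)))
    ≡⟨ cong₂ _+_ (∑-nodes-suc f d f[]≡0) (∑-concatMap-children f (level (suc d))) ⟩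
  ∑ g (nodes d) + ∑ g (level (suc d))                  ≡⟨ sym (∑-++ g (nodes d) _) ⟩
  ∑ g (nodes (suc d)) ∎
  where
  open ≡-Reasoning
  g : Node → ℕ
  g u = f (false ∷ u) + f (true ∷ u)

card≡∑χ : ∀ d A → card d A ≡ ∑ (χ A) (nodes d)
card≡∑χ d A = length-filterᵇ A (nodes d)

card-split : ∀ d {A B C} → (∀ u → χ A u ≡ χ B u + χ C u) → card d A ≡ card d B + card d C
card-split d {A} {B} {C} χ-split = begin
  card d A                                 ≡⟨ card≡∑χ d A ⟩
  ∑ (χ A) (nodes d)                        ≡⟨ ∑-cong χ-split (nodes d) ⟩
  ∑ (λ u → χ B u + χ C u) (nodes d)        ≡⟨ ∑-+ (χ B) (χ C) (nodes d) ⟩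
  ∑ (χ B) (nodes d) + ∑ (χ C) (nodes d)    ≡⟨ sym (cong₂ _+_ (card≡∑χ d B) (card≡∑χ d C)) ⟩
  card d B + card d C ∎
  where open ≡-Reasoning

card-mono : ∀ d {A B} → A ⊆ B → card d A ≤ card d B
card-mono d {A} {B} A⊆B = subst₂ _≤_ (sym (card≡∑χ d A)) (sym (card≡∑χ d B)) (∑-mono χ-mono (nodes d))
  where
  χ-mono : ∀ u → χ A u ≤ χ B u
  χ-mono u with A u in Au
  ... | false = z≤n
  ... | true rewrite A⊆B u Au = ≤-refl

card-pos : ∀ d {A} u → A u ≡ true → length u ≤ d → 1 ≤ card d A
card-pos d {A} u Au ∣u∣≤d = subst (1 ≤_) (sym (card≡∑χ d A)) (begin
  1                              ≡⟨ cong (λ b → if b then 1 else 0) Au ⟨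
  χ A u                          ≤⟨ ≤∑-level (χ A) u ⟩
  ∑ (χ A) (level (length u))     ≤⟨ ∑-level≤∑-nodes (χ A) d ∣u∣≤d ⟩
  ∑ (χ A) (nodes d)              ∎)
  where open ≤-Reasoning

card-internal-suc : ∀ d {A} → A ⊆ internal (suc d) → card (suc d) A ≡ card d A
card-internal-suc d {A} A⊆int = begin
  card (suc d) A                                       ≡⟨ card≡∑χ (suc d) A ⟩
  ∑ (χ A) (nodes d ++ level (suc d))                   ≡⟨ ∑-++ (χ A) (nodes d) _ ⟩
  ∑ (χ A) (nodes d) + ∑ (χ A) (level (suc d))          ≡⟨ cong (∑ (χ A) (nodes d) +_) no-leaves ⟩
  ∑ (χ A) (nodes d) + 0                                ≡⟨ +-identityʳ _ ⟩
  ∑ (χ A) (nodes d)                                    ≡⟨ card≡∑χ d A ⟨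
  card d A ∎
  where
  open ≡-Reasoning
  χ≡0 : ∀ u → length u ≡ suc d → χ A u ≡ 0
  χ≡0 u ∣u∣≡1+d with A u in Au
  ... | false = refl
  ... | true = ⊥-elim (<-irrefl ∣u∣≡1+d (internal⇒< (suc d) u (A⊆int u Au)))
  no-leaves : ∑ (χ A) (level (suc d)) ≡ 0
  no-leaves = ∑-level-≡0 (χ A) (suc d) χ≡0

parentIn : Subset → Subset
parentIn S [] = false
parentIn S (_ ∷ u) = S u

childBoundary : Subset → Subset
childBoundary S u = not (S u) ∧ parentIn S u

tops : Subset → Subset
tops S u = S u ∧ not (parentIn S u)

card-parentIn : ∀ d S → S ⊆ internal d → card d (parentIn S) ≡ card d S + card d S
card-parentIn zero S S⊆int with S [] in S[]
... | false = refl
... | true with () ← S⊆int [] S[]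
card-parentIn (suc d) S S⊆int = begin
  card (suc d) (parentIn S)                   ≡⟨ card≡∑χ (suc d) (parentIn S) ⟩
  ∑ (χ (parentIn S)) (nodes (suc d))          ≡⟨ ∑-nodes-suc (χ (parentIn S)) d refl ⟩
  ∑ (λ u → χ S u + χ S u) (nodes d)           ≡⟨ ∑-+ (χ S) (χ S) (nodes d) ⟩
  ∑ (χ S) (nodes d) + ∑ (χ S) (nodes d)       ≡⟨ cong₂ _+_ (card≡∑χ d S) (card≡∑χ d S) ⟨
  card d S + card d S                         ≡⟨ cong₂ _+_ card-S card-S ⟨
  card (suc d) S + card (suc d) S ∎
  where
  open ≡-Reasoning
  card-S : card (suc d) S ≡ card d S
  card-S = card-internal-suc d S⊆int

card-childBoundary : ∀ d S → S ⊆ internal d →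
  card d (childBoundary S) ≡ card d S + card d (tops S)
card-childBoundary d S S⊆int = +-cancelʳ-≡ (card d (S ∩ parentIn S)) _ _ (begin
  card d (childBoundary S) + inner   ≡⟨ card-split d parentIn-split ⟨
  card d (parentIn S)                ≡⟨ card-parentIn d S S⊆int ⟩
  card d S + card d S                ≡⟨ cong (card d S +_) (card-split d S-split) ⟩
  card d S + (inner + top)           ≡⟨ cong (card d S +_) (+-comm inner top) ⟩
  card d S + (top + inner)           ≡⟨ +-assoc (card d S) top inner ⟨
  card d S + top + inner             ∎)
  where
  open ≡-Reasoning
  inner top : ℕ
  inner = card d (S ∩ parentIn S)
  top = card d (tops S)
  parentIn-split : ∀ u → χ (parentIn S) u ≡ χ (childBoundary S) u + χ (S ∩ parentIn S) u
  parentIn-split u with S u | parentIn S u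
  ... | true | true = refl
  ... | true | false = refl
  ... | false | true = refl
  ... | false | false = refl
  S-split : ∀ u → χ S u ≡ χ (S ∩ parentIn S) u + χ (tops S) u
  S-split u with S u | parentIn S u
  ... | true | true = refl
  ... | true | false = refl
  ... | false | _ = refl

tops-nonempty : ∀ S u → S u ≡ true → ∃ λ v → tops S v ≡ true × length v ≤ length u
tops-nonempty S [] Su = [] , cong (_∧ true) Su , ≤-refl
tops-nonempty S (b ∷ u) Sbu with S u in Su
... | true with v , top , ∣v∣≤∣u∣ ← tops-nonempty S u Su = v , top , m≤n⇒m≤1+n ∣v∣≤∣u∣
... | false = b ∷ u , cong₂ _∧_ Sbu (cong not Su) , ≤-refl

∧-true : ∀ {a b} → a ∧ b ≡ true → a ≡ true × b ≡ true
∧-true {true} {true} refl = refl , refl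

childBoundary⊆∂∩VX : ∀ d r S → S ⊆ VX d r → S ⊆ internal d → childBoundary S ⊆ (∂ d S ∩ VX d r)
childBoundary⊆∂∩VX d r S _ _ [] []∈B with () ← proj₂ (∧-true {not (S [])} []∈B)
childBoundary⊆∂∩VX d r S S⊆VX S⊆int (b ∷ u) bu∈B
  with ∧-true {not (S (b ∷ u))} bu∈B
... | Sbu , Su with inT-u , desc-u ← ∧-true {inT d u} (S⊆VX u Su)
  -- inT d (b ∷ u) reduces to internal d u, which holds as u ∈ S.
  rewrite Sbu | Su | inT-u | desc-u | S⊆int u Su | ∨-zeroʳ (eqNode (b ∷ u) r) = refl

corollary1 : (d : ℕ) (r : Node) → inT d r ≡ true →
    (S : Subset) →
    (∀ u → S u ≡ true → VX d r u ≡ true × internal d u ≡ true) →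
    (card d (∂ d S ∩ VX d r) ≥ card d (S ∩ VX d r))
    × ((∃ λ u → S u ≡ true) → card d (∂ d S ∩ VX d r) ≥ suc (card d (S ∩ VX d r)))
corollary1 d r _ S S⊆VX∩int = ≤-trans (m≤m+n _ _) bound , nonempty-bound
  where
  S⊆VX : S ⊆ VX d r
  S⊆VX u Su = proj₁ (S⊆VX∩int u Su)
  S⊆int : S ⊆ internal d
  S⊆int u Su = proj₂ (S⊆VX∩int u Su)

  bound : card d (S ∩ VX d r) + card d (tops S) ≤ card d (∂ d S ∩ VX d r)
  bound = begin
    card d (S ∩ VX d r) + card d (tops S) ≤⟨ +-monoˡ-≤ _ (card-mono d (λ u → proj₁ ∘ ∧-true)) ⟩
    card d S + card d (tops S)            ≡⟨ card-childBoundary d S S⊆int ⟨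
    card d (childBoundary S)              ≤⟨ card-mono d (childBoundary⊆∂∩VX d r S S⊆VX S⊆int) ⟩
    card d (∂ d S ∩ VX d r)               ∎
    where open ≤-Reasoning

  some-top : ∀ u → S u ≡ true → 1 ≤ card d (tops S)
  some-top u Su with v , top , ∣v∣≤∣u∣ ← tops-nonempty S u Su =
    card-pos d v top (≤-trans ∣v∣≤∣u∣ (<⇒≤ (internal⇒< d u (S⊆int u Su))))

  nonempty-bound : (∃ λ u → S u ≡ true) → suc (card d (S ∩ VX d r)) ≤ card d (∂ d S ∩ VX d r)
  nonempty-bound (u , Su) = begin
    suc (card d (S ∩ VX d r))             ≡⟨ +-comm (card d (S ∩ VX d r)) 1 ⟨
    card d (S ∩ VX d r) + 1               ≤⟨ +-monoʳ-≤ (card d (S ∩ VX d r)) (some-top u Su) ⟩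
    card d (S ∩ VX d r) + card d (tops S) ≤⟨ bound ⟩
    card d (∂ d S ∩ VX d r)               ∎
    where open ≤-Reasoning
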